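{- Let $B$ be an indefinite quaternion algebra over $\mathbb{Q}$ of discriminant $\mathfrak{D}$, and let $\mathcal{O}$ be an Eichler order of $B$ of level $\mathfrak{M}$. For all $v_1,v_2\in\mathcal{O}$, $\mathfrak{D}\mathfrak{M}$ divides $\mathrm{nrd}(v_1v_2-v_2v_1)$.
   Context: $\mathfrak{D}$ is the product of finite primes at which $B$ ramifies. An Eichler order is an intersection of two maximal orders; its level $\mathfrak{M}$ is defined by its reduced discriminant being $\mathfrak{D}\mathfrak{M}$. $\mathrm{nrd}$ is the reduced norm. -}

module Defs where

open import Data.Nat using (ℕ; zero; suc)
open import Data.Integer as ℤ using (ℤ)
open import Data.Rational using (ℚ; 0ℚ; 1ℚ; _+_; _*_; -_; _-_; _≤_; _/_)
open import Data.Fin using (Fin; zero; suc; punchIn)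
open import Data.Product using (Σ; ∃; _×_; _,_)
open import Relation.Binary.PropositionalEquality using (_≡_; _≢_)

ι : ℤ → ℚ
ι n = n / 1

-- The quaternion algebra B = (a,b)_ℚ : basis 1, i, j, k = ij with
-- i² = a, j² = b, ij = -ji.  Every quaternion algebra over ℚ is of
-- this form for some nonzero a, b ∈ ℚ.

record Quat : Set where
  constructor ⟨_,_,_,_⟩
  field
    c₀ c₁ c₂ c₃ : ℚ
open Quat public

0B : Quat
0B = ⟨ 0ℚ , 0ℚ , 0ℚ , 0ℚ ⟩

1B : Quat
1B = ⟨ 1ℚ , 0ℚ , 0ℚ , 0ℚ ⟩

_⊕_ : Quat → Quat → Quat
x ⊕ y = ⟨ c₀ x + c₀ y , c₁ x + c₁ y , c₂ x + c₂ y , c₃ x + c₃ y ⟩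

_⊖_ : Quat → Quat → Quat
x ⊖ y = ⟨ c₀ x - c₀ y , c₁ x - c₁ y , c₂ x - c₂ y , c₃ x - c₃ y ⟩

_·_ : ℤ → Quat → Quat
n · x = ⟨ ι n * c₀ x , ι n * c₁ x , ι n * c₂ x , ι n * c₃ x ⟩

_·ℚ_ : ℚ → Quat → Quat
q ·ℚ x = ⟨ q * c₀ x , q * c₁ x , q * c₂ x , q * c₃ x ⟩

module QuatAlg (a b : ℚ) where

  _⊗_ : Quat → Quat → Quat
  x ⊗ y = ⟨ (c₀ x * c₀ y + a * (c₁ x * c₁ y)) + (b * (c₂ x * c₂ y) - (a * b) * (c₃ x * c₃ y))
          , (c₀ x * c₁ y + c₁ x * c₀ y) + (b * (c₃ x * c₂ y) - b * (c₂ x * c₃ y))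
          , (c₀ x * c₂ y + c₂ x * c₀ y) + (a * (c₁ x * c₃ y) - a * (c₃ x * c₁ y))
          , (c₀ x * c₃ y + c₃ x * c₀ y) + (c₁ x * c₂ y - c₂ x * c₁ y) ⟩

  nrd : Quat → ℚ
  nrd x = ((c₀ x * c₀ x - a * (c₁ x * c₁ x)) - b * (c₂ x * c₂ x)) + (a * b) * (c₃ x * c₃ x)

  trd : Quat → ℚ
  trd x = c₀ x + c₀ x

  -- B is indefinite (B ⊗ ℝ ≅ M₂(ℝ)), i.e. the reduced norm form is not
  -- positive definite.  (Over ℚ ⊂ ℝ dense, this is the same as over ℝ.)
  Indefinite : Set
  Indefinite = Σ Quat λ x → x ≢ 0B × nrd x ≤ 0ℚ

  sumQ : ∀ {n} → (Fin n → Quat) → Quat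
  sumQ {zero}  f = 0B
  sumQ {suc n} f = f zero ⊕ sumQ (λ i → f (suc i))

  -- a ℤ-order of B: a ring (containing 1, closed under multiplication)
  -- which is a full ℤ-lattice, given by a ℤ-basis e₀,…,e₃ that is a
  -- ℚ-basis of B.
  record Order : Set where
    field
      basis : Fin 4 → Quat
      independent : (q : Fin 4 → ℚ) → sumQ (λ i → q i ·ℚ basis i) ≡ 0B → ∀ i → q i ≡ 0ℚ
      spanning : (x : Quat) → Σ (Fin 4 → ℚ) λ q → sumQ (λ i → q i ·ℚ basis i) ≡ x
    _∋_ : Quat → Set
    _∋_ x = Σ (Fin 4 → ℤ) λ n → sumQ (λ i → n i · basis i) ≡ x
    field
      one-mem : _∋_ 1B
      mul-closed : ∀ {x y} → _∋_ x → _∋_ y → _∋_ (x ⊗ y)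

  _∈_ : Quat → Order → Set
  x ∈ O = Order._∋_ O x

  _⊆_ : Order → Order → Set
  O ⊆ O′ = ∀ x → x ∈ O → x ∈ O′

  Maximal : Order → Set
  Maximal O = ∀ O′ → O ⊆ O′ → O′ ⊆ O

  Eichler : Order → Set
  Eichler O = Σ Order λ O₁ → Σ Order λ O₂ → Maximal O₁ × Maximal O₂ ×
              (∀ x → (x ∈ O → x ∈ O₁ × x ∈ O₂) × (x ∈ O₁ × x ∈ O₂ → x ∈ O))

  sumℚ : ∀ {n} → (Fin n → ℚ) → ℚ
  sumℚ {zero}  f = 0ℚ
  sumℚ {suc n} f = f zero + sumℚ (λ i → f (suc i))

  det : ∀ {n} → (Fin n → Fin n → ℚ) → ℚ
  det {zero}  M = 1ℚ
  det {suc n} M = sumℚ λ j → sgn j * (M zero j * det (λ r c → M (suc r) (punchIn j c)))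
    where
    sgn : ∀ {m} → Fin m → ℚ
    sgn zero    = 1ℚ
    sgn (suc i) = - sgn i

  disc : Order → ℚ
  disc O = det λ i j → trd (Order.basis O i ⊗ Order.basis O j)

  IsReducedDisc : Order → ℕ → Set
  IsReducedDisc O N = (ι (ℤ.+ N) * ι (ℤ.+ N) ≡ disc O) ⊎′ (ι (ℤ.+ N) * ι (ℤ.+ N) ≡ - disc O)
    where
    open import Data.Sum using () renaming (_⊎_ to _⊎′_)

  _∣ℚ_ : ℕ → ℚ → Set
  N ∣ℚ q = Σ ℤ λ k → q ≡ ι (ℤ.+ N) * ι k

{-# OPTIONS --safe #-}
module Submission where

open import Defs
open import Data.Nat using (ℕ)
open import Data.Rational using (ℚ; 0ℚ)
open import Data.Product using (_×_)
open import Relation.Binary.PropositionalEquality using (_≢_)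

open import Algebra.Bundles.Raw using (RawRing)
import Algebra.Properties.Group as GroupProperties
open import Data.Nat using (zero; suc)
import Data.Nat as ℕ
import Data.Nat.Coprimality as Coprimality
open import Data.Fin using (Fin; zero; suc; punchIn; combine; _↑ˡ_; _↑ʳ_)
open import Data.Fin.Patterns using (0F; 1F; 2F; 3F)
open import Data.Vec using (Vec; []; _∷_; _++_; tabulate; concat)
open import Data.Product using (Σ; _,_; proj₁)
open import Data.Sum using (_⊎_; inj₁; inj₂)
import Data.Sum as Sum
open import Data.Integer as ℤ using (ℤ; +_; -[1+_]; +[1+_])
import Data.Integer.Properties as ℤ
open import Data.Rational using (1ℚ; mkℚ; _/_; _≤_; NonZero; 1/_; ∣_∣; _≟_; ≢-nonZero)
open import Data.Rational.Properties
  using (*-zeroʳ; *-identityˡ; *-assoc; *-comm; *-inverseˡ; +-inverseʳ; +-0-group;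
         ≤-antisym; neg-antimono-≤; ∣p∣≡p∨∣p∣≡-p; ∣-∣-nonNeg; nonNeg*nonNeg⇒nonNeg;
         nonNegative⁻¹; ↥p/↧p≡p)
open import Data.Rational.Solver using (module +-*-Solver)
open import Relation.Binary.PropositionalEquality
  using (_≡_; refl; sym; trans; cong; cong₂; subst; module ≡-Reasoning)
open import Relation.Nullary using (yes; no)

open +-*-Solver using (Polynomial; con; var; _:+_; _:-_; _:*_; :-_; prove; solve; _:=_)

-- Let E be the matrix of coordinates of a ℤ-basis of O in the basis 1, i, j, k of (a,b)_ℚ.
-- The trace form trd(xy) is diagonal in 1, i, j, k with weights 2, 2a, 2b, -2ab, so
-- disc O = det (E W Eᵀ) = -(4ab det E)², and the reduced discriminant is ±4ab det E.
-- On the other hand nrd(xy - yx) = 4ab det[1; x; y; xy] is a polynomial identity, and for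
-- x, y ∈ O the rows 1, x, y, xy are integer combinations K of the basis, so
-- nrd(xy - yx) = 4ab det K det E is an integer multiple of the reduced discriminant.

Matrix : ∀ {a} → Set a → ℕ → Set a
Matrix A n = Fin n → Fin n → A

infix 8 _ᵀ
_ᵀ : ∀ {a} {A : Set a} {n} → Matrix A n → Matrix A n
(M ᵀ) i j = M j i

entries : ∀ {a} {A : Set a} {n} → Matrix A n → Vec A (n ℕ.* n)
entries M = concat (tabulate λ i → tabulate (M i))

module RawRingAlgebra {c ℓ} (R : RawRing c ℓ) where
  open RawRing R

  ∑ : ∀ {n} → (Fin n → Carrier) → Carrier
  ∑ {zero}  f = 0#
  ∑ {suc n} f = f zero + ∑ (λ i → f (suc i))

  sign : ∀ {n} → Fin n → Carrier
  sign zero    = 1#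
  sign (suc i) = - sign i

  -- Laplace expansion along the first row, as in QuatAlg.det, with which it agrees definitionally.
  det : ∀ {n} → Matrix Carrier n → Carrier
  det {zero}  M = 1#
  det {suc n} M = ∑ λ j → sign j * (M zero j * det (λ r c → M (suc r) (punchIn j c)))

  infixl 7 _⊠_
  _⊠_ : ∀ {n} → Matrix Carrier n → Matrix Carrier n → Matrix Carrier n
  (A ⊠ B) i j = ∑ λ k → A i k * B k j

  diagonal : ∀ {n} → (Fin n → Carrier) → Matrix Carrier n
  diagonal g zero    zero    = g zero
  diagonal g zero    (suc j) = 0#
  diagonal g (suc i) zero    = 0#
  diagonal g (suc i) (suc j) = diagonal (λ k → g (suc k)) i j

  ∑-cong : ∀ {n} {f g : Fin n → Carrier} → (∀ i → f i ≡ g i) → ∑ f ≡ ∑ g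
  ∑-cong {zero}  f≡g = refl
  ∑-cong {suc n} f≡g = cong₂ _+_ (f≡g zero) (∑-cong (λ i → f≡g (suc i)))

  det-cong : ∀ {n} {M N : Matrix Carrier n} → (∀ i j → M i j ≡ N i j) → det M ≡ det N
  det-cong {zero}  M≡N = refl
  det-cong {suc n} M≡N = ∑-cong λ j → cong (λ x → sign j * x)
    (cong₂ _*_ (M≡N zero j) (det-cong (λ r c → M≡N (suc r) (punchIn j c))))

  two four : Carrier
  two  = 1# + 1#
  four = two * two

  module Quaternion (a b : Carrier) where
    private
      infixl 6 _-_
      _-_ : Carrier → Carrier → Carrier
      x - y = x + - y

    _⊗_ : (Fin 4 → Carrier) → (Fin 4 → Carrier) → Fin 4 → Carrier
    (x ⊗ y) 0F = (x 0F * y 0F + a * (x 1F * y 1F)) + (b * (x 2F * y 2F) - (a * b) * (x 3F * y 3F))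
    (x ⊗ y) 1F = (x 0F * y 1F + x 1F * y 0F) + (b * (x 3F * y 2F) - b * (x 2F * y 3F))
    (x ⊗ y) 2F = (x 0F * y 2F + x 2F * y 0F) + (a * (x 1F * y 3F) - a * (x 3F * y 1F))
    (x ⊗ y) 3F = (x 0F * y 3F + x 3F * y 0F) + (x 1F * y 2F - x 2F * y 1F)

    [_,_] : (Fin 4 → Carrier) → (Fin 4 → Carrier) → Fin 4 → Carrier
    [ x , y ] k = (x ⊗ y) k - (y ⊗ x) k

    nrd : (Fin 4 → Carrier) → Carrier
    nrd x = ((x 0F * x 0F - a * (x 1F * x 1F)) - b * (x 2F * x 2F)) + (a * b) * (x 3F * x 3F)

    trd : (Fin 4 → Carrier) → Carrier
    trd x = x 0F + x 0F

    unit : Fin 4 → Carrier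
    unit 0F = 1#
    unit _  = 0#

    trdWeights : Fin 4 → Carrier
    trdWeights 0F = two
    trdWeights 1F = two * a
    trdWeights 2F = two * b
    trdWeights 3F = - (two * (a * b))

-- Evaluating a RawRingAlgebra construction on polynomials gives the same construction on ℚ
-- definitionally, so identities between such constructions are proved by `prove` applied to
-- their polynomial instances.
polynomialRawRing : ℕ → RawRing _ _
polynomialRawRing n = record
  { Carrier = Polynomial n ; _≈_ = _≡_ ; _+_ = _:+_ ; _*_ = _:*_ ; -_ = :-_
  ; 0# = con 0ℚ ; 1# = con 1ℚ }

open RawRingAlgebra Data.Rational.+-*-rawRing
open import Data.Rational using (_+_; _*_; -_; _-_)
module ℤ-Algebra = RawRingAlgebra ℤ.+-*-rawRing
module Poly n = RawRingAlgebra (polynomialRawRing n)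
module +-Group = GroupProperties +-0-group

det-⊠ : (A B : Matrix ℚ 4) → det (A ⊠ B) ≡ det A * det B
det-⊠ A B = prove (entries A ++ entries B) (P.det (X P.⊠ Y)) (P.det X :* P.det Y) refl
  where
  module P = Poly 32
  X Y : Matrix (Polynomial 32) 4
  X i j = var (combine i j ↑ˡ 16)
  Y i j = var (16 ↑ʳ combine i j)

det-ᵀ : (M : Matrix ℚ 4) → det (M ᵀ) ≡ det M
det-ᵀ M = prove (entries M) (P.det (X ᵀ)) (P.det X) refl
  where
  module P = Poly 16
  X : Matrix (Polynomial 16) 4
  X i j = var (combine i j)

-- Rewriting ι into this normal form lets ℚ's _+_ and _*_ compute on ι m and ι n.
ι≡mkℚ : ∀ n → ι n ≡ mkℚ n 0 (Coprimality.sym (Coprimality.1-coprimeTo ℤ.∣ n ∣))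
ι≡mkℚ n = ↥p/↧p≡p (mkℚ n 0 _)

ι-+ : ∀ m n → ι (m ℤ.+ n) ≡ ι m + ι n
ι-+ m n rewrite ι≡mkℚ m | ι≡mkℚ n =
  cong (_/ 1) (cong₂ ℤ._+_ (sym (ℤ.*-identityʳ m)) (sym (ℤ.*-identityʳ n)))

ι-* : ∀ m n → ι (m ℤ.* n) ≡ ι m * ι n
ι-* m n rewrite ι≡mkℚ m | ι≡mkℚ n = refl

ι-neg : ∀ n → ι (ℤ.- n) ≡ - ι n
ι-neg (+ 0)    = refl
ι-neg +[1+ n ] = refl
ι-neg -[1+ n ] = sym (+-Group.⁻¹-involutive (ι +[1+ n ]))

ι-∑ : ∀ {n} (f : Fin n → ℤ) → ι (ℤ-Algebra.∑ f) ≡ ∑ (λ i → ι (f i))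
ι-∑ {zero}  f = refl
ι-∑ {suc n} f = trans (ι-+ (f zero) (ℤ-Algebra.∑ (λ i → f (suc i))))
                      (cong (_+_ (ι (f zero))) (ι-∑ (λ i → f (suc i))))

ι-sign : ∀ {n} (j : Fin n) → ι (ℤ-Algebra.sign j) ≡ sign j
ι-sign zero    = refl
ι-sign (suc j) = trans (ι-neg (ℤ-Algebra.sign j)) (cong -_ (ι-sign j))

ι-det : ∀ {n} (K : Matrix ℤ n) → ι (ℤ-Algebra.det K) ≡ det (λ i j → ι (K i j))
ι-det {zero}  K = refl
ι-det {suc n} K = trans (ι-∑ cofactorTerm) (∑-cong λ j → begin
  ι (cofactorTerm j)
    ≡⟨ ι-* (ℤ-Algebra.sign j) _ ⟩
  ι (ℤ-Algebra.sign j) * ι (K zero j ℤ.* ℤ-Algebra.det (minor j))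
    ≡⟨ cong₂ _*_ (ι-sign j) (ι-* (K zero j) _) ⟩
  sign j * (ι (K zero j) * ι (ℤ-Algebra.det (minor j)))
    ≡⟨ cong (λ x → sign j * (ι (K zero j) * x)) (ι-det (minor j)) ⟩
  sign j * (ι (K zero j) * det (λ r c → ι (minor j r c))) ∎)
  where
  open ≡-Reasoning
  minor : Fin (suc n) → Matrix ℤ n
  minor j r c = K (suc r) (punchIn j c)
  cofactorTerm : Fin (suc n) → ℤ
  cofactorTerm j = ℤ-Algebra.sign j ℤ.* (K zero j ℤ.* ℤ-Algebra.det (minor j))

p*q≡0⇒p≡0∨q≡0 : ∀ p q → p * q ≡ 0ℚ → p ≡ 0ℚ ⊎ q ≡ 0ℚ
p*q≡0⇒p≡0∨q≡0 p q pq≡0 with p ≟ 0ℚ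
... | yes p≡0 = inj₁ p≡0
... | no  p≢0 = inj₂ (begin
  q                 ≡⟨ sym (*-identityˡ q) ⟩
  1ℚ * q            ≡⟨ cong (_* q) (sym (*-inverseˡ p)) ⟩
  (1/ p * p) * q    ≡⟨ *-assoc (1/ p) p q ⟩
  1/ p * (p * q)    ≡⟨ cong (1/ p *_) pq≡0 ⟩
  1/ p * 0ℚ         ≡⟨ *-zeroʳ (1/ p) ⟩
  0ℚ                ∎)
  where
  open ≡-Reasoning
  instance
    p-nonZero : NonZero p
    p-nonZero = ≢-nonZero p≢0

0≤p*p : ∀ p → 0ℚ ≤ p * p
0≤p*p p = subst (0ℚ ≤_) ∣p∣*∣p∣≡p*p (nonNegative⁻¹ (∣ p ∣ * ∣ p ∣))
  where
  instance
    ∣p∣-nonNeg = ∣-∣-nonNeg p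
    ∣p∣²-nonNeg = nonNeg*nonNeg⇒nonNeg (∣ p ∣) (∣ p ∣)
  ∣p∣*∣p∣≡p*p : ∣ p ∣ * ∣ p ∣ ≡ p * p
  ∣p∣*∣p∣≡p*p with ∣p∣≡p∨∣p∣≡-p p
  ... | inj₁ ∣p∣≡p  = cong₂ _*_ ∣p∣≡p ∣p∣≡p
  ... | inj₂ ∣p∣≡-p = trans (cong₂ _*_ ∣p∣≡-p ∣p∣≡-p) (solve 1 (λ x → :- x :* :- x := x :* x) refl p)

p*p≡q*q⇒p≡q∨p≡-q : ∀ p q → p * p ≡ q * q → p ≡ q ⊎ p ≡ - q
p*p≡q*q⇒p≡q∨p≡-q p q p²≡q² =
  Sum.map (+-Group.x∙y⁻¹≈ε⇒x≈y p q) (+-Group.inverseˡ-unique p q)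
          (p*q≡0⇒p≡0∨q≡0 (p - q) (p + q) [p-q][p+q]≡0)
  where
  open ≡-Reasoning
  [p-q][p+q]≡0 : (p - q) * (p + q) ≡ 0ℚ
  [p-q][p+q]≡0 = begin
    (p - q) * (p + q)  ≡⟨ solve 2 (λ p q → (p :- q) :* (p :+ q) := p :* p :- q :* q) refl p q ⟩
    p * p - q * q      ≡⟨ cong (_- q * q) p²≡q² ⟩
    q * q - q * q      ≡⟨ +-inverseʳ (q * q) ⟩
    0ℚ                 ∎

p*p≡-[q*q]⇒q≡0 : ∀ p q → p * p ≡ - (q * q) → q ≡ 0ℚ
p*p≡-[q*q]⇒q≡0 p q p²≡-q² = Sum.reduce (p*q≡0⇒p≡0∨q≡0 q q (≤-antisym q²≤0 (0≤p*p q)))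
  where
  q²≤0 : q * q ≤ 0ℚ
  q²≤0 = subst (_≤ 0ℚ) (trans (cong -_ p²≡-q²) (+-Group.⁻¹-involutive (q * q)))
           (neg-antimono-≤ (0≤p*p p))

square-root-divides-multiple : ∀ (N : ℕ) {D q x : ℚ} (m : ℤ) →
  ι (+ N) * ι (+ N) ≡ D ⊎ ι (+ N) * ι (+ N) ≡ - D → D ≡ - (q * q) → x ≡ ι m * q →
  Σ ℤ λ k → x ≡ ι (+ N) * ι k
square-root-divides-multiple N {D} {q} {x} m (inj₁ N²≡D) D≡-q² x≡mq = + 0 , (begin
  x               ≡⟨ x≡mq ⟩
  ι m * q         ≡⟨ cong (ι m *_) (p*p≡-[q*q]⇒q≡0 (ι (+ N)) q (trans N²≡D D≡-q²)) ⟩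
  ι m * 0ℚ        ≡⟨ *-zeroʳ (ι m) ⟩
  0ℚ              ≡⟨ sym (*-zeroʳ (ι (+ N))) ⟩
  ι (+ N) * 0ℚ    ∎)
  where open ≡-Reasoning
square-root-divides-multiple N {D} {q} {x} m (inj₂ N²≡-D) D≡-q² x≡mq =
  Sum.[ from-N≡q , from-N≡-q ]′ (p*p≡q*q⇒p≡q∨p≡-q (ι (+ N)) q N²≡q²)
  where
  open ≡-Reasoning
  N²≡q² : ι (+ N) * ι (+ N) ≡ q * q
  N²≡q² = trans N²≡-D (trans (cong -_ D≡-q²) (+-Group.⁻¹-involutive (q * q)))
  from-N≡q : ι (+ N) ≡ q → Σ ℤ λ k → x ≡ ι (+ N) * ι k
  from-N≡q N≡q = m , trans x≡mq (trans (cong (ι m *_) (sym N≡q)) (*-comm (ι m) (ι (+ N))))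
  from-N≡-q : ι (+ N) ≡ - q → Σ ℤ λ k → x ≡ ι (+ N) * ι k
  from-N≡-q N≡-q = ℤ.- m , (begin
    x                   ≡⟨ x≡mq ⟩
    ι m * q             ≡⟨ cong (ι m *_) (sym (+-Group.⁻¹-involutive q)) ⟩
    ι m * - - q         ≡⟨ cong (λ n → ι m * - n) (sym N≡-q) ⟩
    ι m * - ι (+ N)     ≡⟨ solve 2 (λ m n → m :* :- n := n :* :- m) refl (ι m) (ι (+ N)) ⟩
    ι (+ N) * - ι m     ≡⟨ cong (ι (+ N) *_) (sym (ι-neg m)) ⟩
    ι (+ N) * ι (ℤ.- m) ∎)

coords : Quat → Fin 4 → ℚ
coords x 0F = c₀ x
coords x 1F = c₁ x
coords x 2F = c₂ x
coords x 3F = c₃ x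

coordinateMatrix : (Fin 4 → Quat) → Matrix ℚ 4
coordinateMatrix e i j = coords (e i) j

module _ (a b : ℚ) where
  open QuatAlg a b using (_⊗_; nrd; trd)
  open Quaternion a b using (trdWeights)

  frame : Quat → Quat → Fin 4 → Quat
  frame x y 0F = 1B
  frame x y 1F = x
  frame x y 2F = y
  frame x y 3F = x ⊗ y

  private
    env : Quat → Quat → Vec ℚ 10
    env x y = a ∷ b ∷ tabulate (coords x) ++ tabulate (coords y)

    module P = Poly 10

    A B : Polynomial 10
    A = var 0F
    B = var 1F

    X Y : Fin 4 → Polynomial 10
    X k = var (suc (suc (k ↑ˡ 4)))
    Y k = var (suc (suc (4 ↑ʳ k)))

    module PQ = P.Quaternion A B

  -- For rows x = E i and y = E j of a matrix E, the right-hand side is ((E ⊠ W) ⊠ E ᵀ) i j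
  -- with W = diagonal trdWeights.
  trd-⊗ : ∀ x y → trd (x ⊗ y) ≡ ∑ λ k → (∑ λ l → coords x l * diagonal trdWeights l k) * coords y k
  trd-⊗ x y = prove (env x y) (PQ.trd (X PQ.⊗ Y))
    (P.∑ λ k → (P.∑ λ l → X l :* P.diagonal PQ.trdWeights l k) :* Y k) refl

  nrd-commutator : ∀ x y →
    nrd ((x ⊗ y) ⊖ (y ⊗ x)) ≡ (four * (a * b)) * det (coordinateMatrix (frame x y))
  nrd-commutator x y =
    prove (env x y) (PQ.nrd PQ.[ X , Y ]) ((P.four :* (A :* B)) :* P.det frameP) refl
    where
    frameP : Matrix (Polynomial 10) 4
    frameP 0F = PQ.unit
    frameP 1F = X
    frameP 2F = Y
    frameP 3F = X PQ.⊗ Y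

  d*det[W]*d≡-[4abd]² : ∀ d → (d * det (diagonal trdWeights)) * d ≡
                             - ((four * (a * b) * d) * (four * (a * b) * d))
  d*det[W]*d≡-[4abd]² d = prove (a ∷ b ∷ d ∷ []) ((D :* P₃.det (P₃.diagonal PQ₃.trdWeights)) :* D)
    (:- ((P₃.four :* (var 0F :* var 1F) :* D) :* (P₃.four :* (var 0F :* var 1F) :* D))) refl
    where
    module P₃ = Poly 3
    module PQ₃ = P₃.Quaternion (var 0F) (var 1F)
    D : Polynomial 3
    D = var 2F

  module _ (O : QuatAlg.Order a b) where
    open QuatAlg a b using (_∈_; disc)
    open QuatAlg.Order O using (basis; one-mem; mul-closed)

    basisCoords : Matrix ℚ 4
    basisCoords = coordinateMatrix basis

    discRoot : ℚ
    discRoot = four * (a * b) * det basisCoords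

    disc≡-[discRoot]² : disc O ≡ - (discRoot * discRoot)
    disc≡-[discRoot]² = begin
      disc O                                ≡⟨⟩
      det (λ i j → trd (basis i ⊗ basis j)) ≡⟨ det-cong (λ i j → trd-⊗ (basis i) (basis j)) ⟩
      det ((E ⊠ W) ⊠ E ᵀ)                   ≡⟨ det-⊠ (E ⊠ W) (E ᵀ) ⟩
      det (E ⊠ W) * det (E ᵀ)               ≡⟨ cong₂ _*_ (det-⊠ E W) (det-ᵀ E) ⟩
      (det E * det W) * det E               ≡⟨ d*det[W]*d≡-[4abd]² (det E) ⟩
      - (discRoot * discRoot)               ∎
      where
      open ≡-Reasoning
      E W : Matrix ℚ 4
      E = basisCoords
      W = diagonal trdWeights

    coords-∈ : ∀ {x} (x∈O : x ∈ O) j → coords x j ≡ ∑ λ k → ι (proj₁ x∈O k) * basisCoords k j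
    coords-∈ (n , refl) 0F = refl
    coords-∈ (n , refl) 1F = refl
    coords-∈ (n , refl) 2F = refl
    coords-∈ (n , refl) 3F = refl

    nrd-commutator-∈ : ∀ {v₁ v₂} → v₁ ∈ O → v₂ ∈ O →
      Σ ℤ λ m → nrd ((v₁ ⊗ v₂) ⊖ (v₂ ⊗ v₁)) ≡ ι m * discRoot
    nrd-commutator-∈ {v₁} {v₂} v₁∈O v₂∈O = ℤ-Algebra.det K , (begin
      nrd ((v₁ ⊗ v₂) ⊖ (v₂ ⊗ v₁))              ≡⟨ nrd-commutator v₁ v₂ ⟩
      c * det (coordinateMatrix (frame v₁ v₂)) ≡⟨ cong (c *_) (det-cong (λ i → coords-∈ (frame-∈ i))) ⟩
      c * det (ιK ⊠ E)                         ≡⟨ cong (c *_) (det-⊠ ιK E) ⟩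
      c * (det ιK * det E)                     ≡⟨ cong (λ m → c * (m * det E)) (sym (ι-det K)) ⟩
      c * (ι (ℤ-Algebra.det K) * det E)        ≡⟨ solve 3 (λ c m d → c :* (m :* d) := m :* (c :* d))
                                                    refl c (ι (ℤ-Algebra.det K)) (det E) ⟩
      ι (ℤ-Algebra.det K) * discRoot           ∎)
      where
      open ≡-Reasoning
      E : Matrix ℚ 4
      E = basisCoords
      c : ℚ
      c = four * (a * b)
      frame-∈ : ∀ i → frame v₁ v₂ i ∈ O
      frame-∈ 0F = one-mem
      frame-∈ 1F = v₁∈O
      frame-∈ 2F = v₂∈O
      frame-∈ 3F = mul-closed v₁∈O v₂∈O
      K : Matrix ℤ 4
      K i = proj₁ (frame-∈ i)
      ιK : Matrix ℚ 4
      ιK i j = ι (K i j)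

lemma3p2 : (a b : ℚ) → a ≢ 0ℚ → b ≢ 0ℚ → QuatAlg.Indefinite a b →
    (O : QuatAlg.Order a b) → QuatAlg.Eichler a b O →
    (DM : ℕ) → QuatAlg.IsReducedDisc a b O DM →
    ∀ v₁ v₂ → QuatAlg._∈_ a b v₁ O → QuatAlg._∈_ a b v₂ O →
    QuatAlg._∣ℚ_ a b DM (QuatAlg.nrd a b (_⊖_ (QuatAlg._⊗_ a b v₁ v₂) (QuatAlg._⊗_ a b v₂ v₁)))
lemma3p2 a b _ _ _ O _ DM reduced v₁ v₂ v₁∈O v₂∈O =
  let m , nrd≡m*discRoot = nrd-commutator-∈ a b O v₁∈O v₂∈O
  in square-root-divides-multiple DM m reduced (disc≡-[discRoot]² a b O) nrd≡m*discRoot
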